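{- Let $p\ge 1$ be an integer. For each $k\in\{2,3,\dots,\lfloor\frac{9p-1}{2}\rfloor\}$ such that $\frac{9p}{\gcd(9p,k)}=3s$ for some positive integer $s$, the circulant graph $C_{9p}(1,k)$ is Type I, i.e. its total chromatic number equals $5$.
   Context: For integers $n$ and $1\le d_1<d_2<\dots<d_l\le\lfloor n/2\rfloor$, the circulant graph $C_n(d_1,\dots,d_l)$ has vertex set $\{0,1,\dots,n-1\}$, with $x$ and $y$ adjacent iff $x\equiv y\pm d_i \pmod n$ for some $i$. A total coloring of a graph $G$ assigns colors to vertices and edges so that adjacent vertices receive different colors, edges sharing an endpoint receive different colors, and each edge receives a color different from its two endpoints. The total chromatic number $\chi''(G)$ is the minimum number of colors in a total coloring; always $\chi''(G)\ge\Delta(G)+1$. A graph is Type I if $\chi''(G)=\Delta(G)+1$. -}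

module Defs where

open import Data.Nat using (ℕ; zero; suc; _+_; _*_; _<_; _≟_)
open import Data.Nat.DivMod using (_/_; _%_)
open import Data.Nat.GCD using (gcd)
open import Data.Nat.Base using (≢-nonZero)
open import Data.Fin using (Fin; toℕ)
open import Data.List using (List)
open import Data.List.Membership.Propositional using (_∈_)
open import Data.Product using (Σ; ∃; _×_; _,_)
open import Data.Sum using (_⊎_)
open import Relation.Nullary using (¬_; yes; no)
open import Relation.Binary.PropositionalEquality using (_≡_; _≢_)

-- n / gcd(n,k); the gcd is nonzero whenever n ≠ 0 (the only case used);
-- the value 0 in the degenerate case gcd n k = 0 (i.e. n = k = 0) is a dummy.
quotByGcd : ℕ → ℕ → ℕ
quotByGcd n k with gcd n k ≟ 0
... | yes _ = 0
... | no ne = (n / gcd n k) {{≢-nonZero ne}}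

Graph : ℕ → Set₁
Graph n = Fin n → Fin n → Set

Circulant : (n : ℕ) → List ℕ → Graph n
Circulant zero ds ()
Circulant (suc m) ds x y =
  (x ≢ y) ×
  (∃ λ d → (d ∈ ds) ×
     (((toℕ y + d) % suc m ≡ toℕ x) ⊎ ((toℕ x + d) % suc m ≡ toℕ y)))

-- A total coloring of G with m colors: vertex colors and edge colors
-- (edge colors given on ordered pairs, required symmetric on edges).
record TotalColoring {n : ℕ} (G : Graph n) (m : ℕ) : Set where
  field
    vcol : Fin n → Fin m
    ecol : Fin n → Fin n → Fin m
    ecol-sym : ∀ x y → G x y → ecol x y ≡ ecol y x
    vertex-proper : ∀ x y → G x y → vcol x ≢ vcol y
    edge-proper : ∀ x y z → G x y → G x z → y ≢ z → ecol x y ≢ ecol x z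
    incidence-proper : ∀ x y → G x y → ecol x y ≢ vcol x

TotalColorable : {n : ℕ} → Graph n → ℕ → Set
TotalColorable G m = TotalColoring G m

TotalChromaticNumber≡ : {n : ℕ} → Graph n → ℕ → Set
TotalChromaticNumber≡ G χ = TotalColorable G χ × (∀ m → m < χ → ¬ TotalColorable G m)

-- Five colours are forced by the degree: once 2k < n, vertex 0 of C_n(1, k) has the four
-- distinct neighbours 1, k, n − k, n − 1.  Conversely, a 5-total-colouring of the graph on ℕ
-- with edges {v, v + 1}, {v, v + k} that is periodic modulo a divisor M of n = 9p descends to
-- C_n(1, k): only k mod M matters, and for 2k < n the four neighbours of a vertex are distinct.
-- If 9 ∤ k, one of eight explicit colourings of period 9 applies, so the gcd hypothesis is only
-- needed when 9 ∣ k.  Then g = gcd(9p, k) is a multiple of 9 with 3g ∣ 9p and k ≡ ±g (mod 3g),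
-- and it suffices to colour C_{3g}(1, g).  Its vertex v gets the coordinates
-- (v mod 3, ⌊v / g⌋ mod 3), and a single colouring of the 3 × 3 grid works for every g.

module Submission where

open import Algebra.Properties.CommutativeSemigroup using (xy∙z≈xz∙y; x∙yz≈y∙xz)
open import Data.Empty using (⊥; ⊥-elim)
open import Data.Fin using (Fin; zero; suc; toℕ; fromℕ; fromℕ<; #_)
open import Data.Fin.Properties
  using (toℕ-injective; toℕ<n; toℕ-fromℕ<; fromℕ<-cong; fromℕ<-injective; all?; pigeonhole)
  renaming (_≟_ to _≟ᶠ_; <⇒≢ to <⇒≢ᶠ)
open import Data.List using (_∷_; [])
open import Data.List.Membership.Propositional using (_∈_)
open import Data.List.Relation.Unary.Any using (here; there)
open import Data.Nat using (ℕ; zero; suc; _+_; _*_; _∸_; _≤_; _<_; NonZero; >-nonZero⁻¹; ≢-nonZero; z≤n; s≤s)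
open import Data.Nat.DivMod
open import Data.Nat.Divisibility
  using (_∣_; divides; n∣m*n; m∣m*n; ∣-refl; ∣-trans; ∣⇒≤; n∣m⇒m%n≡0; m%n≡0⇒n∣m)
open import Data.Nat.GCD using (gcd; gcd[m,n]∣m; gcd[m,n]∣n; gcd-greatest; gcd[m,n]≢0)
open import Data.Nat.Properties
open import Data.Product using (_×_; _,_; proj₁; proj₂; ∃)
open import Data.Sum using (_⊎_; inj₁; inj₂)
open import Data.Vec using (Vec; _∷_; []; lookup)
open import Data.Vec.Relation.Unary.All using (All; _∷_; [])
open import Data.Vec.Relation.Unary.All.Properties using (lookup⁺)
open import Data.Vec.Relation.Unary.AllPairs using (_∷_; []; allPairs?)
open import Data.Vec.Relation.Unary.Unique.Propositional using (Unique)
open import Data.Vec.Relation.Unary.Unique.Propositional.Properties using (lookup-injective)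
open import Defs
open import Function using (_∘_)
open import Relation.Binary.PropositionalEquality
open import Relation.Nullary using (¬_; yes; no)
open import Relation.Nullary.Decidable using (Dec; True; toWitness; from-yes; ¬?; _×-dec_; _⊎-dec_; _→-dec_)

[m%n+o]%n≡[m+o]%n : ∀ m o n .{{_ : NonZero n}} → (m % n + o) % n ≡ (m + o) % n
[m%n+o]%n≡[m+o]%n m o n = begin
  (m % n + o) % n         ≡⟨ %-distribˡ-+ (m % n) o n ⟩
  (m % n % n + o % n) % n ≡⟨ cong (λ x → (x + o % n) % n) (m%n%n≡m%n m n) ⟩
  (m % n + o % n) % n     ≡⟨ %-distribˡ-+ m o n ⟨
  (m + o) % n             ∎
  where open ≡-Reasoning

[m+o%n]%n≡[m+o]%n : ∀ m o n .{{_ : NonZero n}} → (m + o % n) % n ≡ (m + o) % n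
[m+o%n]%n≡[m+o]%n m o n = begin
  (m + o % n) % n ≡⟨ cong (_% n) (+-comm m (o % n)) ⟩
  (o % n + m) % n ≡⟨ [m%n+o]%n≡[m+o]%n o m n ⟩
  (o + m) % n     ≡⟨ cong (_% n) (+-comm o m) ⟩
  (m + o) % n     ∎
  where open ≡-Reasoning

+-congˡ-mod : ∀ m {o p} n .{{_ : NonZero n}} → o % n ≡ p % n → (m + o) % n ≡ (m + p) % n
+-congˡ-mod m {o} {p} n eq = begin
  (m + o) % n     ≡⟨ [m+o%n]%n≡[m+o]%n m o n ⟨
  (m + o % n) % n ≡⟨ cong (λ x → (m + x) % n) eq ⟩
  (m + p % n) % n ≡⟨ [m+o%n]%n≡[m+o]%n m p n ⟩
  (m + p) % n     ∎
  where open ≡-Reasoning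

+-congʳ-mod : ∀ {m o} p n .{{_ : NonZero n}} → m % n ≡ o % n → (m + p) % n ≡ (o + p) % n
+-congʳ-mod {m} {o} p n eq = begin
  (m + p) % n     ≡⟨ [m%n+o]%n≡[m+o]%n m p n ⟨
  (m % n + p) % n ≡⟨ cong (λ x → (x + p) % n) eq ⟩
  (o % n + p) % n ≡⟨ [m%n+o]%n≡[m+o]%n o p n ⟩
  (o + p) % n     ∎
  where open ≡-Reasoning

m+[n∸m%n]≡[1+m/n]*n : ∀ m n .{{_ : NonZero n}} → m + (n ∸ m % n) ≡ suc (m / n) * n
m+[n∸m%n]≡[1+m/n]*n m n = begin
  m + (n ∸ m % n)                   ≡⟨ cong (_+ (n ∸ m % n)) (m≡m%n+[m/n]*n m n) ⟩
  m % n + m / n * n + (n ∸ m % n)   ≡⟨ cong (_+ (n ∸ m % n)) (+-comm (m % n) (m / n * n)) ⟩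
  m / n * n + m % n + (n ∸ m % n)   ≡⟨ +-assoc (m / n * n) (m % n) (n ∸ m % n) ⟩
  m / n * n + (m % n + (n ∸ m % n)) ≡⟨ cong (m / n * n +_) (m+[n∸m]≡n (m%n≤n m n)) ⟩
  m / n * n + n                     ≡⟨ +-comm (m / n * n) n ⟩
  suc (m / n) * n                   ∎
  where open ≡-Reasoning

-- A representative of w − j modulo n that avoids truncated subtraction.
stepBack : ∀ n .{{_ : NonZero n}} → ℕ → ℕ → ℕ
stepBack n j w = w + (n ∸ j % n)

[m+o]+[n∸o%n]%n≡m%n : ∀ m o n .{{_ : NonZero n}} → (m + o + (n ∸ o % n)) % n ≡ m % n
[m+o]+[n∸o%n]%n≡m%n m o n = begin
  (m + o + (n ∸ o % n)) % n   ≡⟨ cong (_% n) (+-assoc m o (n ∸ o % n)) ⟩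
  (m + (o + (n ∸ o % n))) % n ≡⟨ cong (λ x → (m + x) % n) (m+[n∸m%n]≡[1+m/n]*n o n) ⟩
  (m + suc (o / n) * n) % n   ≡⟨ [m+kn]%n≡m%n m (suc (o / n)) n ⟩
  m % n                       ∎
  where open ≡-Reasoning

+-cancelʳ-mod : ∀ m o p n .{{_ : NonZero n}} → (m + p) % n ≡ (o + p) % n → m % n ≡ o % n
+-cancelʳ-mod m o p n eq = begin
  m % n                     ≡⟨ [m+o]+[n∸o%n]%n≡m%n m p n ⟨
  (m + p + (n ∸ p % n)) % n ≡⟨ +-congʳ-mod (n ∸ p % n) n eq ⟩
  (o + p + (n ∸ p % n)) % n ≡⟨ [m+o]+[n∸o%n]%n≡m%n o p n ⟩
  o % n                     ∎
  where open ≡-Reasoning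

stepBack-+ : ∀ n .{{_ : NonZero n}} j w → (stepBack n j w + j) % n ≡ w % n
stepBack-+ n j w =
  trans (cong (_% n) (xy∙z≈xz∙y +-commutativeSemigroup w (n ∸ j % n) j)) ([m+o]+[n∸o%n]%n≡m%n w j n)

stepBack-unique : ∀ n .{{_ : NonZero n}} {j u w} → (u + j) % n ≡ w % n → u % n ≡ stepBack n j w % n
stepBack-unique n {j} {u} {w} eq =
  +-cancelʳ-mod u (stepBack n j w) j n (trans eq (sym (stepBack-+ n j w)))

m<n⇒[m+o]%n≢m : ∀ {m o n} .{{_ : NonZero n}} → m < n → 0 < o → o < n → (m + o) % n ≢ m
m<n⇒[m+o]%n≢m {m} {o} {n} m<n 0<o o<n eq with m + o <? n
... | yes m+o<n = <⇒≢ (m<m+n m 0<o) (sym (trans (sym (m<n⇒m%n≡m m+o<n)) eq))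
... | no m+o≮n =
  <⇒≢ wrapped<m (trans (sym (m<n⇒m%n≡m (<-trans wrapped<m m<n))) (trans (m≤n⇒[n∸m]%m≡n%m n≤m+o) eq))
  where
  n≤m+o : n ≤ m + o
  n≤m+o = ≮⇒≥ m+o≮n
  wrapped<m : m + o ∸ n < m
  wrapped<m = subst (m + o ∸ n <_) (m+n∸n≡m m n) (∸-monoˡ-< (+-monoʳ-< m o<n) n≤m+o)

m∣n⇒[o≡p]%n⇒[o≡p]%m : ∀ {m n} .{{_ : NonZero m}} .{{_ : NonZero n}} → m ∣ n →
                       ∀ {o p} → o % n ≡ p % n → o % m ≡ p % m
m∣n⇒[o≡p]%n⇒[o≡p]%m {m} {n} m∣n {o} {p} eq = begin
  o % m     ≡⟨ m∣n⇒o%n%m≡o%m m n o m∣n ⟨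
  o % n % m ≡⟨ cong (_% m) eq ⟩
  p % n % m ≡⟨ m∣n⇒o%n%m≡o%m m n p m∣n ⟩
  p % m     ∎
  where open ≡-Reasoning

toℕ-mod : ∀ m n .{{_ : NonZero n}} → toℕ (m mod n) ≡ m % n
toℕ-mod m n = toℕ-fromℕ< (m%n<n m n)

mod-cong : ∀ {m o n} .{{_ : NonZero n}} → m % n ≡ o % n → m mod n ≡ o mod n
mod-cong eq = fromℕ<-cong _ _ eq _ _

toℕ-mod-+ : ∀ m o n .{{_ : NonZero n}} → (toℕ (m mod n) + o) % n ≡ (m + o) % n
toℕ-mod-+ m o n = trans (cong (λ x → (x + o) % n) (toℕ-mod m n)) ([m%n+o]%n≡[m+o]%n m o n)

[1+m]/n≡[1+m%n]/n+m/n : ∀ m n .{{_ : NonZero n}} → suc m / n ≡ suc (m % n) / n + m / n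
[1+m]/n≡[1+m%n]/n+m/n m n = begin
  suc m / n                       ≡⟨ cong (λ x → suc x / n) (m≡m%n+[m/n]*n m n) ⟩
  (suc (m % n) + m / n * n) / n   ≡⟨ +-distrib-/-∣ʳ (suc (m % n)) (n∣m*n (m / n)) ⟩
  suc (m % n) / n + m / n * n / n ≡⟨ cong (suc (m % n) / n +_) (m*n/n≡m (m / n) n) ⟩
  suc (m % n) / n + m / n         ∎
  where open ≡-Reasoning

suc-/-cases : ∀ m n .{{_ : NonZero n}} → suc m / n ≡ m / n ⊎ (n ∣ suc m × suc m / n ≡ suc (m / n))
suc-/-cases m n with m≤n⇒m<n∨m≡n (m%n<n m n)
... | inj₁ 1+r<n = inj₁ (begin
  suc m / n               ≡⟨ [1+m]/n≡[1+m%n]/n+m/n m n ⟩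
  suc (m % n) / n + m / n ≡⟨ cong (_+ m / n) (m<n⇒m/n≡0 1+r<n) ⟩
  m / n                   ∎)
  where open ≡-Reasoning
... | inj₂ 1+r≡n = inj₂ (divides (suc (m / n)) 1+m≡[1+m/n]*n , (begin
  suc m / n               ≡⟨ [1+m]/n≡[1+m%n]/n+m/n m n ⟩
  suc (m % n) / n + m / n ≡⟨ cong (λ x → x / n + m / n) 1+r≡n ⟩
  n / n + m / n           ≡⟨ cong (_+ m / n) (n/n≡1 n) ⟩
  suc (m / n)             ∎))
  where
  open ≡-Reasoning
  1+m≡[1+m/n]*n : suc m ≡ suc (m / n) * n
  1+m≡[1+m/n]*n = trans (cong suc (m≡m%n+[m/n]*n m n)) (cong (_+ m / n * n) 1+r≡n)

-- edge₁ v and edgeₖ v colour the edges {v, v + 1} and {v, v + k} of the graph on ℕ.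
record PeriodicTotalColouring (n k c : ℕ) .{{_ : NonZero n}} : Set where
  field
    vertex edge₁ edgeₖ : ℕ → Fin c
    vertex-periodic : ∀ {v w} → v % n ≡ w % n → vertex v ≡ vertex w
    edge₁-periodic  : ∀ {v w} → v % n ≡ w % n → edge₁ v ≡ edge₁ w
    edgeₖ-periodic  : ∀ {v w} → v % n ≡ w % n → edgeₖ v ≡ edgeₖ w
    vertex-proper₁  : ∀ v → vertex v ≢ vertex (v + 1)
    vertex-properₖ  : ∀ v → vertex v ≢ vertex (v + k)
    star-proper     : ∀ {w u t} → (u + 1) % n ≡ w % n → (t + k) % n ≡ w % n →
                      Unique (vertex w ∷ edge₁ w ∷ edge₁ u ∷ edgeₖ w ∷ edgeₖ t ∷ [])

liftPeriod : ∀ {M n k r c} .{{_ : NonZero M}} .{{_ : NonZero n}} → M ∣ n → k % M ≡ r % M →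
             PeriodicTotalColouring M r c → PeriodicTotalColouring n k c
liftPeriod {M} {n} {k} {r} M∣n k≡r P = record
  { vertex = vertex ; edge₁ = edge₁ ; edgeₖ = edgeₖ
  ; vertex-periodic = vertex-periodic ∘ reduce
  ; edge₁-periodic  = edge₁-periodic ∘ reduce
  ; edgeₖ-periodic  = edgeₖ-periodic ∘ reduce
  ; vertex-proper₁  = vertex-proper₁
  ; vertex-properₖ  = λ v →
      subst (vertex v ≢_) (vertex-periodic (+-congˡ-mod v M (sym k≡r))) (vertex-properₖ v)
  ; star-proper     = λ {t = t} u~w t~w →
      star-proper (reduce u~w) (trans (+-congˡ-mod t M (sym k≡r)) (reduce t~w))
  }
  where
  open PeriodicTotalColouring P
  reduce : ∀ {o p} → o % n ≡ p % n → o % M ≡ p % M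
  reduce = m∣n⇒[o≡p]%n⇒[o≡p]%m M∣n

unique-swap₄₅ : ∀ {A : Set} {a b c d e : A} →
                Unique (a ∷ b ∷ c ∷ d ∷ e ∷ []) → Unique (a ∷ b ∷ c ∷ e ∷ d ∷ [])
unique-swap₄₅
  ((a≢b ∷ a≢c ∷ a≢d ∷ a≢e ∷ []) ∷ (b≢c ∷ b≢d ∷ b≢e ∷ []) ∷ (c≢d ∷ c≢e ∷ []) ∷ (d≢e ∷ []) ∷ [] ∷ []) =
  (a≢b ∷ a≢c ∷ a≢e ∷ a≢d ∷ []) ∷ (b≢c ∷ b≢e ∷ b≢d ∷ []) ∷ (c≢e ∷ c≢d ∷ []) ∷ (≢-sym d≢e ∷ []) ∷ [] ∷ []

-- C_M(1, r) and C_M(1, r′) are the same graph when r + r′ ≡ 0 (mod M).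
negateJump : ∀ {M r r′ c} .{{_ : NonZero M}} → (r + r′) % M ≡ 0 →
             PeriodicTotalColouring M r c → PeriodicTotalColouring M r′ c
negateJump {M} {r} {r′} r+r′≡0 P = record
  { vertex = vertex ; edge₁ = edge₁ ; edgeₖ = λ v → edgeₖ (v + r′)
  ; vertex-periodic = vertex-periodic
  ; edge₁-periodic  = edge₁-periodic
  ; edgeₖ-periodic  = edgeₖ-periodic ∘ +-congʳ-mod r′ M
  ; vertex-proper₁  = vertex-proper₁
  ; vertex-properₖ  = λ v eq → vertex-properₖ (v + r′) (trans (sym eq) (sym (vertex-periodic (back v))))
  ; star-proper     = λ {w} {u} u~w t~w →
      subst (λ x → Unique (vertex w ∷ edge₁ w ∷ edge₁ u ∷ edgeₖ (w + r′) ∷ x ∷ []))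
            (edgeₖ-periodic (sym t~w))
            (unique-swap₄₅ (star-proper u~w (back w)))
  }
  where
  open PeriodicTotalColouring P
  back : ∀ v → (v + r′ + r) % M ≡ v % M
  back v = begin
    (v + r′ + r) % M   ≡⟨ cong (_% M) (trans (+-assoc v r′ r) (cong (v +_) (+-comm r′ r))) ⟩
    (v + (r + r′)) % M ≡⟨ +-congˡ-mod v M (trans r+r′≡0 (sym (m<n⇒m%n≡m (>-nonZero⁻¹ M)))) ⟩
    (v + 0) % M        ≡⟨ cong (_% M) (+-identityʳ v) ⟩
    v % M              ∎
    where open ≡-Reasoning

module FromPeriodic {n′ k c} (2≤k : 2 ≤ k) (2k<N : k + k < suc n′)
                    (P : PeriodicTotalColouring (suc n′) k c) where
  open PeriodicTotalColouring P

  N : ℕ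
  N = suc n′

  G : Graph N
  G = Circulant N (1 ∷ k ∷ [])

  1≤k : 1 ≤ k
  1≤k = ≤-trans (s≤s z≤n) 2≤k

  k<N : k < N
  k<N = ≤-<-trans (m≤m+n k k) 2k<N

  data Step (x y : ℕ) : Set where
    fwd₁ : (x + 1) % N ≡ y → Step x y
    bwd₁ : (y + 1) % N ≡ x → Step x y
    fwdₖ : (x + k) % N ≡ y → Step x y
    bwdₖ : (y + k) % N ≡ x → Step x y

  step : ∀ {x y} → G x y → Step (toℕ x) (toℕ y)
  step (_ , _ , here refl , inj₁ p)         = bwd₁ p
  step (_ , _ , here refl , inj₂ p)         = fwd₁ p
  step (_ , _ , there (here refl) , inj₁ p) = bwdₖ p
  step (_ , _ , there (here refl) , inj₂ p) = fwdₖ p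

  flip : ∀ {x y} → Step x y → Step y x
  flip (fwd₁ p) = bwd₁ p
  flip (bwd₁ p) = fwd₁ p
  flip (fwdₖ p) = bwdₖ p
  flip (bwdₖ p) = fwdₖ p

  colour : ∀ {x y} → Step x y → Fin c
  colour {x} (fwd₁ _)     = edge₁ x
  colour {y = y} (bwd₁ _) = edge₁ y
  colour {x} (fwdₖ _)     = edgeₖ x
  colour {y = y} (bwdₖ _) = edgeₖ y

  colour-flip : ∀ {x y} (s : Step x y) → colour (flip s) ≡ colour s
  colour-flip (fwd₁ _) = refl
  colour-flip (bwd₁ _) = refl
  colour-flip (fwdₖ _) = refl
  colour-flip (bwdₖ _) = refl

  no-cycle : ∀ {x y a b} → x < N → 1 ≤ a → a ≤ k → b ≤ k → (x + a) % N ≡ y → (y + b) % N ≡ x → ⊥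
  no-cycle {x} {y} {a} {b} x<N 1≤a a≤k b≤k x→y y→x =
    m<n⇒[m+o]%n≢m x<N (≤-trans 1≤a (m≤m+n a b)) (≤-<-trans (+-mono-≤ a≤k b≤k) 2k<N) (begin
      (x + (a + b)) % N     ≡⟨ cong (_% N) (+-assoc x a b) ⟨
      (x + a + b) % N       ≡⟨ [m%n+o]%n≡[m+o]%n (x + a) b N ⟨
      ((x + a) % N + b) % N ≡⟨ cong (λ z → (z + b) % N) x→y ⟩
      (y + b) % N           ≡⟨ y→x ⟩
      x                     ∎)
    where open ≡-Reasoning

  no-double : ∀ x {y} → (x + 1) % N ≡ y → (x + k) % N ≡ y → ⊥
  no-double x x→₁y x→ₖy = <⇒≢ 2≤k (begin
    1     ≡⟨ m<n⇒m%n≡m (≤-<-trans 1≤k k<N) ⟨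
    1 % N ≡⟨ +-cancelʳ-mod 1 k x N (trans (cong (_% N) (+-comm 1 x))
               (trans (trans x→₁y (sym x→ₖy)) (cong (_% N) (+-comm x k)))) ⟩
    k % N ≡⟨ m<n⇒m%n≡m k<N ⟩
    k     ∎)
    where open ≡-Reasoning

  colour-unique : ∀ {x y} → x < N → (s s′ : Step x y) → colour s ≡ colour s′
  colour-unique _ (fwd₁ _) (fwd₁ _) = refl
  colour-unique _ (bwd₁ _) (bwd₁ _) = refl
  colour-unique _ (fwdₖ _) (fwdₖ _) = refl
  colour-unique _ (bwdₖ _) (bwdₖ _) = refl
  colour-unique x<N (fwd₁ p) (bwd₁ q) = ⊥-elim (no-cycle x<N ≤-refl 1≤k 1≤k p q)
  colour-unique x<N (bwd₁ p) (fwd₁ q) = ⊥-elim (no-cycle x<N ≤-refl 1≤k 1≤k q p)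
  colour-unique {x} x<N (fwd₁ p) (fwdₖ q) = ⊥-elim (no-double x p q)
  colour-unique {x} x<N (fwdₖ p) (fwd₁ q) = ⊥-elim (no-double x q p)
  colour-unique x<N (fwd₁ p) (bwdₖ q) = ⊥-elim (no-cycle x<N ≤-refl 1≤k ≤-refl p q)
  colour-unique x<N (bwdₖ p) (fwd₁ q) = ⊥-elim (no-cycle x<N ≤-refl 1≤k ≤-refl q p)
  colour-unique x<N (bwd₁ p) (fwdₖ q) = ⊥-elim (no-cycle x<N 1≤k ≤-refl 1≤k q p)
  colour-unique x<N (fwdₖ p) (bwd₁ q) = ⊥-elim (no-cycle x<N 1≤k ≤-refl 1≤k p q)
  colour-unique {y = y} x<N (bwd₁ p) (bwdₖ q) = ⊥-elim (no-double y p q)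
  colour-unique {y = y} x<N (bwdₖ p) (bwd₁ q) = ⊥-elim (no-double y q p)
  colour-unique x<N (fwdₖ p) (bwdₖ q) = ⊥-elim (no-cycle x<N 1≤k ≤-refl ≤-refl p q)
  colour-unique x<N (bwdₖ p) (fwdₖ q) = ⊥-elim (no-cycle x<N 1≤k ≤-refl ≤-refl q p)

  step? : ∀ x y → Dec (Step x y)
  step? x y with (x + 1) % N ≟ y | (y + 1) % N ≟ x | (x + k) % N ≟ y | (y + k) % N ≟ x
  ... | yes p | _     | _     | _     = yes (fwd₁ p)
  ... | no _  | yes p | _     | _     = yes (bwd₁ p)
  ... | no _  | no _  | yes p | _     = yes (fwdₖ p)
  ... | no _  | no _  | no _  | yes p = yes (bwdₖ p)
  ... | no ¬p | no ¬q | no ¬r | no ¬s =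
    no λ { (fwd₁ p) → ¬p p ; (bwd₁ q) → ¬q q ; (fwdₖ r) → ¬r r ; (bwdₖ s) → ¬s s }

  -- Non-adjacent pairs get an arbitrary colour.
  edgeColour : ℕ → ℕ → Fin c
  edgeColour x y with step? x y
  ... | yes s = colour s
  ... | no _  = vertex x

  edgeColour-step : ∀ {x y} → x < N → (s : Step x y) → edgeColour x y ≡ colour s
  edgeColour-step {x} {y} x<N s with step? x y
  ... | yes s′ = colour-unique x<N s′ s
  ... | no ¬s  = ⊥-elim (¬s s)

  -- Entry i of star x colours x itself (i = 0) or its edge to entry i of neighbours x.
  star : ℕ → Vec (Fin c) 5
  star x = vertex x ∷ edge₁ x ∷ edge₁ (stepBack N 1 x) ∷ edgeₖ x ∷ edgeₖ (stepBack N k x) ∷ []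

  neighbours : ℕ → Vec ℕ 5
  neighbours x = x ∷ (x + 1) % N ∷ stepBack N 1 x % N ∷ (x + k) % N ∷ stepBack N k x % N ∷ []

  position : ∀ {x y} → Step x y → Fin 5
  position (fwd₁ _) = # 1
  position (bwd₁ _) = # 2
  position (fwdₖ _) = # 3
  position (bwdₖ _) = # 4

  position≢0 : ∀ {x y} (s : Step x y) → position s ≢ # 0
  position≢0 (fwd₁ _) ()
  position≢0 (bwd₁ _) ()
  position≢0 (fwdₖ _) ()
  position≢0 (bwdₖ _) ()

  star-unique : ∀ x → Unique (star x)
  star-unique x = star-proper {x} {stepBack N 1 x} {stepBack N k x} (stepBack-+ N 1 x) (stepBack-+ N k x)

  reduced : ∀ a {b} → a % N ≡ b → b < N → a % N ≡ b % N
  reduced a a≡b b<N = trans a≡b (sym (m<n⇒m%n≡m b<N))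

  stepBack-bwd : ∀ j {x} y → x < N → (y + j) % N ≡ x → y % N ≡ stepBack N j x % N
  stepBack-bwd j {x} y x<N y→x = stepBack-unique N {j} {y} {x} (reduced (y + j) y→x x<N)

  colour-star : ∀ {x y} → x < N → (s : Step x y) → colour s ≡ lookup (star x) (position s)
  colour-star         x<N (fwd₁ _) = refl
  colour-star {y = y} x<N (bwd₁ p) = edge₁-periodic (stepBack-bwd 1 y x<N p)
  colour-star         x<N (fwdₖ _) = refl
  colour-star {y = y} x<N (bwdₖ p) = edgeₖ-periodic (stepBack-bwd k y x<N p)

  neighbour-position : ∀ {x y} → x < N → y < N → (s : Step x y) → y ≡ lookup (neighbours x) (position s)
  neighbour-position         x<N y<N (fwd₁ p) = sym p
  neighbour-position {y = y} x<N y<N (bwd₁ p) = trans (sym (m<n⇒m%n≡m y<N)) (stepBack-bwd 1 y x<N p)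
  neighbour-position         x<N y<N (fwdₖ p) = sym p
  neighbour-position {y = y} x<N y<N (bwdₖ p) = trans (sym (m<n⇒m%n≡m y<N)) (stepBack-bwd k y x<N p)

  vertex-proper : ∀ {x y} → x < N → y < N → Step x y → vertex x ≢ vertex y
  vertex-proper {x} {y} x<N y<N (fwd₁ p) eq =
    vertex-proper₁ x (trans eq (vertex-periodic (sym (reduced (x + 1) p y<N))))
  vertex-proper {x} {y} x<N y<N (bwd₁ p) eq =
    vertex-proper₁ y (trans (sym eq) (vertex-periodic (sym (reduced (y + 1) p x<N))))
  vertex-proper {x} {y} x<N y<N (fwdₖ p) eq =
    vertex-properₖ x (trans eq (vertex-periodic (sym (reduced (x + k) p y<N))))
  vertex-proper {x} {y} x<N y<N (bwdₖ p) eq =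
    vertex-properₖ y (trans (sym eq) (vertex-periodic (sym (reduced (y + k) p x<N))))

  colour-injective : ∀ {x y z} → x < N → y < N → z < N → (s : Step x y) (s′ : Step x z) →
                     colour s ≡ colour s′ → y ≡ z
  colour-injective {x} x<N y<N z<N s s′ eq = begin
    _                                  ≡⟨ neighbour-position x<N y<N s ⟩
    lookup (neighbours x) (position s)  ≡⟨ cong (lookup (neighbours x)) same-position ⟩
    lookup (neighbours x) (position s′) ≡⟨ neighbour-position x<N z<N s′ ⟨
    _                                  ∎
    where
    open ≡-Reasoning
    same-position : position s ≡ position s′
    same-position = lookup-injective (star-unique x) (position s) (position s′)
      (trans (sym (colour-star x<N s)) (trans eq (colour-star x<N s′)))

  colour≢vertex : ∀ {x y} → x < N → (s : Step x y) → colour s ≢ vertex x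
  colour≢vertex x<N s eq =
    position≢0 s (lookup-injective (star-unique _) (position s) (# 0) (trans (sym (colour-star x<N s)) eq))

  totalColouring : TotalColoring G c
  totalColouring = record
    { vcol = λ x → vertex (toℕ x)
    ; ecol = λ x y → edgeColour (toℕ x) (toℕ y)
    ; ecol-sym = λ x y x~y →
        trans (edgeColour-step (toℕ<n x) (step x~y))
              (sym (trans (edgeColour-step (toℕ<n y) (flip (step x~y))) (colour-flip (step x~y))))
    ; vertex-proper = λ x y x~y → vertex-proper (toℕ<n x) (toℕ<n y) (step x~y)
    ; edge-proper = λ x y z x~y x~z y≢z eq →
        y≢z (toℕ-injective (colour-injective (toℕ<n x) (toℕ<n y) (toℕ<n z) (step x~y) (step x~z)
          (trans (sym (edgeColour-step (toℕ<n x) (step x~y)))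
                 (trans eq (edgeColour-step (toℕ<n x) (step x~z))))))
    ; incidence-proper = λ x y x~y eq →
        colour≢vertex (toℕ<n x) (step x~y) (trans (sym (edgeColour-step (toℕ<n x) (step x~y))) eq)
    }

distinct-neighbours⇒¬TotalColoring : ∀ {n d m} {G : Graph n} (x : Fin n) (ys : Vec (Fin n) d) →
  Unique ys → All (G x) ys → m ≤ d → ¬ TotalColoring G m
distinct-neighbours⇒¬TotalColoring {d = d} {m} x ys unique adjacent m≤d tc =
  let i , j , i<j , same = pigeonhole (s≤s m≤d) colours in <⇒≢ᶠ i<j (colours-injective i j same)
  where
  open TotalColoring tc
  colours : Fin (suc d) → Fin m
  colours zero    = vcol x
  colours (suc i) = ecol x (lookup ys i)
  colours-injective : ∀ i j → colours i ≡ colours j → i ≡ j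
  colours-injective zero    zero    _  = refl
  colours-injective zero    (suc j) eq = ⊥-elim (incidence-proper x _ (lookup⁺ adjacent j) (sym eq))
  colours-injective (suc i) zero    eq = ⊥-elim (incidence-proper x _ (lookup⁺ adjacent i) eq)
  colours-injective (suc i) (suc j) eq with i ≟ᶠ j
  ... | yes i≡j = cong suc i≡j
  ... | no i≢j  = ⊥-elim (edge-proper x _ _ (lookup⁺ adjacent i) (lookup⁺ adjacent j)
                           (i≢j ∘ lookup-injective unique i j) eq)

circulant-¬TotalColoring : ∀ {n′ k m} → 2 ≤ k → k + k < suc n′ → m ≤ 4 →
  ¬ TotalColoring (Circulant (suc n′) (1 ∷ k ∷ [])) m
circulant-¬TotalColoring {n′} {k} 2≤k 2k<N =
  distinct-neighbours⇒¬TotalColoring zero (fromℕ< 1<N ∷ fromℕ< k<N ∷ fromℕ< N∸k<N ∷ fromℕ< n′<N ∷ [])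
    ( (distinct 1<N k<N 2≤k ∷ distinct 1<N N∸k<N 1<N∸k ∷ distinct 1<N n′<N 1<n′ ∷ [])
    ∷ (distinct k<N N∸k<N k<N∸k ∷ distinct k<N n′<N k<n′ ∷ [])
    ∷ (distinct N∸k<N n′<N N∸k<n′ ∷ [])
    ∷ [] ∷ [])
    ( adjacent 1<N (s≤s z≤n) (here refl) (inj₂ (m<n⇒m%n≡m 1<N))
    ∷ adjacent k<N 0<k (there (here refl)) (inj₂ (m<n⇒m%n≡m k<N))
    ∷ adjacent N∸k<N 0<N∸k (there (here refl)) (inj₁ (trans (cong (_% N) (m∸n+n≡m (<⇒≤ k<N))) (n%n≡0 N)))
    ∷ adjacent n′<N 0<n′ (here refl) (inj₁ (trans (cong (_% N) (+-comm n′ 1)) (n%n≡0 N)))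
    ∷ [])
  where
  N : ℕ
  N = suc n′
  G : Graph N
  G = Circulant N (1 ∷ k ∷ [])
  distinct : ∀ {a b} (a<N : a < N) (b<N : b < N) → a < b → fromℕ< a<N ≢ fromℕ< b<N
  distinct {a} {b} a<N b<N a<b eq = <⇒≢ a<b (fromℕ<-injective a b a<N b<N eq)
  adjacent : ∀ {a d} (a<N : a < N) → 0 < a → d ∈ 1 ∷ k ∷ [] →
             (a + d) % N ≡ 0 ⊎ d % N ≡ a → G zero (fromℕ< a<N)
  adjacent {a} {d} a<N 0<a d∈ link =
    (λ eq → <⇒≢ 0<a (trans (cong toℕ eq) (toℕ-fromℕ< a<N))) , d , d∈ ,
    subst (λ b → (b + d) % N ≡ 0 ⊎ d % N ≡ b) (sym (toℕ-fromℕ< a<N)) link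
  0<k : 0 < k
  0<k = ≤-trans (s≤s z≤n) 2≤k
  k<N : k < N
  k<N = ≤-<-trans (m≤m+n k k) 2k<N
  k<N∸k : k < N ∸ k
  k<N∸k = m+n≤o⇒m≤o∸n (suc k) 2k<N
  N∸k<n′ : N ∸ k < n′
  N∸k<n′ = ∸-monoʳ-< 2≤k (<⇒≤ k<N)
  n′<N : n′ < N
  n′<N = n<1+n n′
  N∸k<N : N ∸ k < N
  N∸k<N = <-trans N∸k<n′ n′<N
  1<N∸k : 1 < N ∸ k
  1<N∸k = <-trans 2≤k k<N∸k
  1<n′ : 1 < n′
  1<n′ = <-trans 1<N∸k N∸k<n′
  k<n′ : k < n′
  k<n′ = <-trans k<N∸k N∸k<n′
  1<N : 1 < N
  1<N = <-trans 1<n′ n′<N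
  0<N∸k : 0 < N ∸ k
  0<N∸k = <-trans 0<k k<N∸k
  0<n′ : 0 < n′
  0<n′ = <-trans 0<k k<n′

module FinLiterals where
  open import Agda.Builtin.FromNat public using (fromNat)
  open import Data.Unit using (tt)
  import Data.Fin.Literals as Fin
  import Data.Nat.Literals as Nat
  instance
    ⊤-instance = tt
    ℕ-literals = Nat.number
    Fin-literals = λ {n} → Fin.number n

module Tabulated {M c : ℕ} .{{_ : NonZero M}} (r : ℕ) (vertexᵀ edge₁ᵀ edgeₖᵀ : Vec (Fin c) M) where

  vertex edge₁ edgeₖ : ℕ → Fin c
  vertex v = lookup vertexᵀ (v mod M)
  edge₁ v  = lookup edge₁ᵀ (v mod M)
  edgeₖ v  = lookup edgeₖᵀ (v mod M)

  star : ℕ → ℕ → ℕ → Vec (Fin c) 5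
  star w u t = vertex w ∷ edge₁ w ∷ edge₁ u ∷ edgeₖ w ∷ edgeₖ t ∷ []

  ProperAt : ℕ → Set
  ProperAt v = vertex v ≢ vertex (v + 1) × vertex v ≢ vertex (v + r)
             × Unique (star v (stepBack M 1 v) (stepBack M r v))

  properAt? : ∀ v → Dec (ProperAt v)
  properAt? v = ¬? (_ ≟ᶠ _) ×-dec ¬? (_ ≟ᶠ _) ×-dec allPairs? (λ x y → ¬? (x ≟ᶠ y)) _

  proper? : Dec (∀ (i : Fin M) → ProperAt (toℕ i))
  proper? = all? (properAt? ∘ toℕ)

  lookup-periodic : ∀ (T : Vec (Fin c) M) {v w} → v % M ≡ w % M → lookup T (v mod M) ≡ lookup T (w mod M)
  lookup-periodic T = cong (lookup T) ∘ mod-cong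

  toℕ-mod-periodic : ∀ v → toℕ (v mod M) % M ≡ v % M
  toℕ-mod-periodic v = trans (cong (_% M) (toℕ-mod v M)) (m%n%n≡m%n v M)

  star-periodic : ∀ {w u t w′ u′ t′} → w % M ≡ w′ % M → u % M ≡ u′ % M → t % M ≡ t′ % M →
                  star w u t ≡ star w′ u′ t′
  star-periodic w≡ u≡ t≡ =
    cong₂ _∷_ (lookup-periodic vertexᵀ w≡) (cong₂ _∷_ (lookup-periodic edge₁ᵀ w≡)
      (cong₂ _∷_ (lookup-periodic edge₁ᵀ u≡) (cong₂ _∷_ (lookup-periodic edgeₖᵀ w≡)
        (cong₂ _∷_ (lookup-periodic edgeₖᵀ t≡) refl))))

  vertex-shift : ∀ v a → vertex (toℕ (v mod M)) ≢ vertex (toℕ (v mod M) + a) → vertex v ≢ vertex (v + a)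
  vertex-shift v a =
    subst₂ _≢_ (lookup-periodic vertexᵀ (toℕ-mod-periodic v)) (lookup-periodic vertexᵀ (toℕ-mod-+ v a M))

  fromTable : (∀ (i : Fin M) → ProperAt (toℕ i)) → PeriodicTotalColouring M r c
  fromTable proper = record
    { vertex = vertex ; edge₁ = edge₁ ; edgeₖ = edgeₖ
    ; vertex-periodic = lookup-periodic vertexᵀ
    ; edge₁-periodic  = lookup-periodic edge₁ᵀ
    ; edgeₖ-periodic  = lookup-periodic edgeₖᵀ
    ; vertex-proper₁  = λ v → vertex-shift v 1 (proj₁ (proper (v mod M)))
    ; vertex-properₖ  = λ v → vertex-shift v r (proj₁ (proj₂ (proper (v mod M))))
    ; star-proper     = λ {w} u~w t~w →
        subst Unique
          (star-periodic (toℕ-mod-periodic w)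
            (sym (stepBack-unique M (trans u~w (sym (toℕ-mod-periodic w)))))
            (sym (stepBack-unique M (trans t~w (sym (toℕ-mod-periodic w))))))
          (proj₂ (proj₂ (proper (w mod M))))
    }

tabulated : ∀ {M c} .{{_ : NonZero M}} (r : ℕ) (vertexᵀ edge₁ᵀ edgeₖᵀ : Vec (Fin c) M) →
            {True (Tabulated.proper? r vertexᵀ edge₁ᵀ edgeₖᵀ)} → PeriodicTotalColouring M r c
tabulated r vertexᵀ edge₁ᵀ edgeₖᵀ {valid} =
  Tabulated.fromTable r vertexᵀ edge₁ᵀ edgeₖᵀ
    (toWitness {a? = Tabulated.proper? r vertexᵀ edge₁ᵀ edgeₖᵀ} valid)

module NineTables where
  open FinLiterals

  nine₁ : PeriodicTotalColouring 9 1 5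
  nine₁ = tabulated 1
    (0 ∷ 3 ∷ 1 ∷ 0 ∷ 2 ∷ 1 ∷ 0 ∷ 4 ∷ 1 ∷ [])
    (1 ∷ 0 ∷ 2 ∷ 1 ∷ 0 ∷ 2 ∷ 1 ∷ 0 ∷ 3 ∷ [])
    (2 ∷ 4 ∷ 3 ∷ 4 ∷ 3 ∷ 4 ∷ 3 ∷ 2 ∷ 4 ∷ [])

  nine₂ : PeriodicTotalColouring 9 2 5
  nine₂ = tabulated 2
    (0 ∷ 2 ∷ 4 ∷ 0 ∷ 2 ∷ 3 ∷ 0 ∷ 2 ∷ 1 ∷ [])
    (1 ∷ 0 ∷ 1 ∷ 4 ∷ 0 ∷ 4 ∷ 3 ∷ 0 ∷ 3 ∷ [])
    (2 ∷ 3 ∷ 3 ∷ 2 ∷ 1 ∷ 1 ∷ 2 ∷ 4 ∷ 4 ∷ [])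

  nine₃ : PeriodicTotalColouring 9 3 5
  nine₃ = tabulated 3
    (0 ∷ 2 ∷ 1 ∷ 3 ∷ 4 ∷ 3 ∷ 2 ∷ 3 ∷ 2 ∷ [])
    (1 ∷ 0 ∷ 4 ∷ 0 ∷ 1 ∷ 4 ∷ 0 ∷ 1 ∷ 4 ∷ [])
    (2 ∷ 3 ∷ 2 ∷ 1 ∷ 2 ∷ 0 ∷ 3 ∷ 4 ∷ 3 ∷ [])

  nine₄ : PeriodicTotalColouring 9 4 5
  nine₄ = tabulated 4
    (0 ∷ 2 ∷ 1 ∷ 0 ∷ 3 ∷ 1 ∷ 0 ∷ 4 ∷ 1 ∷ [])
    (1 ∷ 0 ∷ 4 ∷ 1 ∷ 0 ∷ 2 ∷ 1 ∷ 0 ∷ 3 ∷ [])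
    (2 ∷ 3 ∷ 3 ∷ 3 ∷ 4 ∷ 4 ∷ 4 ∷ 2 ∷ 2 ∷ [])

  nine₅ : PeriodicTotalColouring 9 5 5
  nine₅ = tabulated 5
    (0 ∷ 2 ∷ 1 ∷ 0 ∷ 2 ∷ 3 ∷ 0 ∷ 2 ∷ 4 ∷ [])
    (1 ∷ 0 ∷ 4 ∷ 3 ∷ 0 ∷ 1 ∷ 4 ∷ 0 ∷ 3 ∷ [])
    (2 ∷ 3 ∷ 3 ∷ 2 ∷ 4 ∷ 4 ∷ 2 ∷ 1 ∷ 1 ∷ [])

  nine₆ : PeriodicTotalColouring 9 6 5
  nine₆ = tabulated 6
    (0 ∷ 2 ∷ 1 ∷ 2 ∷ 3 ∷ 2 ∷ 3 ∷ 4 ∷ 3 ∷ [])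
    (1 ∷ 0 ∷ 4 ∷ 0 ∷ 1 ∷ 4 ∷ 0 ∷ 1 ∷ 4 ∷ [])
    (2 ∷ 3 ∷ 2 ∷ 3 ∷ 4 ∷ 3 ∷ 1 ∷ 2 ∷ 0 ∷ [])

  nine₇ : PeriodicTotalColouring 9 7 5
  nine₇ = tabulated 7
    (0 ∷ 2 ∷ 1 ∷ 0 ∷ 4 ∷ 1 ∷ 0 ∷ 3 ∷ 1 ∷ [])
    (1 ∷ 3 ∷ 2 ∷ 1 ∷ 2 ∷ 4 ∷ 1 ∷ 4 ∷ 3 ∷ [])
    (2 ∷ 0 ∷ 4 ∷ 4 ∷ 0 ∷ 3 ∷ 3 ∷ 0 ∷ 2 ∷ [])

  nine₈ : PeriodicTotalColouring 9 8 5
  nine₈ = tabulated 8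
    (0 ∷ 2 ∷ 1 ∷ 0 ∷ 2 ∷ 4 ∷ 0 ∷ 2 ∷ 3 ∷ [])
    (1 ∷ 0 ∷ 2 ∷ 1 ∷ 0 ∷ 1 ∷ 3 ∷ 0 ∷ 4 ∷ [])
    (2 ∷ 3 ∷ 4 ∷ 3 ∷ 4 ∷ 3 ∷ 2 ∷ 4 ∷ 1 ∷ [])

module PrismPattern where
  open FinLiterals

  next : Fin 3 → Fin 3
  next i = (toℕ i + 1) mod 3

  -- The possible coordinates (g′, y′) of v + 1 in the prism when v has coordinates (g, y): the
  -- row advances exactly when v + 1 crosses a multiple of m, which, as 3 ∣ m, forces g = 2.
  Successor : Fin 3 → Fin 3 → Fin 3 → Fin 3 → Set
  Successor g y g′ y′ = g′ ≡ next g × (y′ ≡ y ⊎ g ≡ fromℕ 2 × y′ ≡ next y)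

  successor? : ∀ g y g′ y′ → Dec (Successor g y g′ y′)
  successor? g y g′ y′ = g′ ≟ᶠ next g ×-dec (y′ ≟ᶠ y ⊎-dec g ≟ᶠ fromℕ 2 ×-dec y′ ≟ᶠ next y)

  -- Indexed by the row y, then by the column g.
  colourᵀ : Vec (Vec (Fin 5) 3) 3
  colourᵀ = (0 ∷ 2 ∷ 3 ∷ []) ∷ (4 ∷ 3 ∷ 0 ∷ []) ∷ (3 ∷ 0 ∷ 1 ∷ []) ∷ []

  edge₁ᵀ : Vec (Fin 5) 3
  edge₁ᵀ = 1 ∷ 4 ∷ 2 ∷ []

  colour : Fin 3 → Fin 3 → Fin 5
  colour g y = lookup (lookup colourᵀ y) g

  colour-column-proper : ∀ g y → colour g y ≢ colour g (next y)
  colour-column-proper = from-yes (all? λ g → all? λ y → ¬? (colour g y ≟ᶠ colour g (next y)))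

  star : Fin 3 → Fin 3 → Fin 3 → Fin 3 → Vec (Fin 5) 5
  star g y g′ y′ =
    colour g′ y′ ∷ lookup edge₁ᵀ g′ ∷ lookup edge₁ᵀ g ∷ colour g′ (next (next y′)) ∷ colour g′ (next y′) ∷ []

  colour-successor-proper : ∀ g y g′ y′ → Successor g y g′ y′ →
                            colour g y ≢ colour g′ y′ × Unique (star g y g′ y′)
  colour-successor-proper = from-yes (all? λ g → all? λ y → all? λ g′ → all? λ y′ →
    successor? g y g′ y′ →-dec
      ¬? (colour g y ≟ᶠ colour g′ y′) ×-dec allPairs? (λ a b → ¬? (a ≟ᶠ b)) (star g y g′ y′))

module Prism (m : ℕ) .{{_ : NonZero m}} (3∣m : 3 ∣ m) where
  instance
    3m≢0 : NonZero (3 * m)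
    3m≢0 = m*n≢0 3 m

  open PrismPattern

  col row : ℕ → Fin 3
  col v = v mod 3
  row v = (v / m) mod 3

  col-+1 : ∀ v → col (v + 1) ≡ next (col v)
  col-+1 v = mod-cong {v + 1} {toℕ (col v) + 1} (sym (toℕ-mod-+ v 1 3))

  row-+1 : ∀ v → row (v + 1) ≡ row v ⊎ col v ≡ fromℕ 2 × row (v + 1) ≡ next (row v)
  row-+1 v rewrite +-comm v 1 with suc-/-cases v m
  ... | inj₁ same = inj₁ (cong (_mod 3) same)
  ... | inj₂ (m∣1+v , later) = inj₂
    ( mod-cong {v} {2} (%-pred-≡0 {v} (n∣m⇒m%n≡0 _ 3 (∣-trans 3∣m m∣1+v)))
    , mod-cong {suc v / m} {toℕ (row v) + 1}
        (trans (cong (_% 3) (trans later (+-comm 1 (v / m)))) (sym (toℕ-mod-+ (v / m) 1 3))) )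

  col-+m : ∀ v → col (v + m) ≡ col v
  col-+m v = mod-cong {v + m} {v} (%-remove-+ʳ v 3∣m)

  row-+m : ∀ v → row (v + m) ≡ next (row v)
  row-+m v = mod-cong {(v + m) / m} {toℕ (row v) + 1} (begin
    (v + m) / m % 3       ≡⟨ cong (_% 3) (+-distrib-/-∣ʳ v ∣-refl) ⟩
    (v / m + m / m) % 3   ≡⟨ cong (λ x → (v / m + x) % 3) (n/n≡1 m) ⟩
    (v / m + 1) % 3       ≡⟨ toℕ-mod-+ (v / m) 1 3 ⟨
    (toℕ (row v) + 1) % 3 ∎)
    where open ≡-Reasoning

  coords-periodic : ∀ {v w} → v % (3 * m) ≡ w % (3 * m) → col v ≡ col w × row v ≡ row w
  coords-periodic {v} {w} eq =
    mod-cong {v} {w} (m∣n⇒[o≡p]%n⇒[o≡p]%m (m∣m*n {3} m) eq) , mod-cong {v / m} {w / m} v/m≡w/m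
    where
    open ≡-Reasoning
    v/m≡w/m : v / m % 3 ≡ w / m % 3
    v/m≡w/m = begin
      v / m % 3       ≡⟨ m%[n*o]/o≡m/o%n v 3 m ⟨
      v % (3 * m) / m ≡⟨ cong (_/ m) eq ⟩
      w % (3 * m) / m ≡⟨ m%[n*o]/o≡m/o%n w 3 m ⟩
      w / m % 3       ∎

  coords-+1 : ∀ {u w} → (u + 1) % (3 * m) ≡ w % (3 * m) → Successor (col u) (row u) (col w) (row w)
  coords-+1 {u} eq with coords-periodic eq | row-+1 u
  ... | col≡ , row≡ | inj₁ same =
    trans (sym col≡) (col-+1 u) , inj₁ (trans (sym row≡) same)
  ... | col≡ , row≡ | inj₂ (2≡ , next≡) =
    trans (sym col≡) (col-+1 u) , inj₂ (2≡ , trans (sym row≡) next≡)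

  vertex edge₁ edgeₖ : ℕ → Fin 5
  vertex v = colour (col v) (row v)
  edge₁ v  = lookup edge₁ᵀ (col v)
  -- The m-edges form the triangles {v, v + m, v + 2m}; each takes the colour of the opposite vertex.
  edgeₖ v  = vertex (v + m + m)

  vertex-+m : ∀ v → vertex (v + m) ≡ colour (col v) (next (row v))
  vertex-+m v = cong₂ colour (col-+m v) (row-+m v)

  vertex-periodic : ∀ {v w} → v % (3 * m) ≡ w % (3 * m) → vertex v ≡ vertex w
  vertex-periodic eq = cong₂ colour (proj₁ (coords-periodic eq)) (proj₂ (coords-periodic eq))

  prism : PeriodicTotalColouring (3 * m) m 5
  prism = record
    { vertex = vertex ; edge₁ = edge₁ ; edgeₖ = edgeₖ
    ; vertex-periodic = vertex-periodic
    ; edge₁-periodic  = cong (lookup edge₁ᵀ) ∘ proj₁ ∘ coords-periodic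
    ; edgeₖ-periodic  = vertex-periodic ∘ +-congʳ-mod m (3 * m) ∘ +-congʳ-mod m (3 * m)
    ; vertex-proper₁  = λ v → proj₁ (colour-successor-proper _ _ _ _ (coords-+1 {v} refl))
    ; vertex-properₖ  = λ v eq → colour-column-proper (col v) (row v) (trans eq (vertex-+m v))
    ; star-proper     = λ {w} {u} u~w t~w →
        subst Unique
          (cong₂ (λ a b → vertex w ∷ edge₁ w ∷ edge₁ u ∷ a ∷ b ∷ [])
            (sym (trans (vertex-+m (w + m)) (cong₂ colour (col-+m w) (cong next (row-+m w)))))
            (sym (trans (vertex-periodic (+-congʳ-mod m (3 * m) t~w)) (vertex-+m w))))
          (proj₂ (colour-successor-proper _ _ _ _ (coords-+1 u~w)))
    }

m<3*m : ∀ {m} → 0 < m → m < 3 * m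
m<3*m {m} 0<m = m<m+n m (≤-trans 0<m (m≤m+n m (m + 0)))

3g∤g : ∀ g .{{_ : NonZero g}} → ¬ (3 * g ∣ g)
3g∤g g 3g∣g = <⇒≱ (m<3*m (>-nonZero⁻¹ g)) (∣⇒≤ 3g∣g)

prismPeriodicColouring : ∀ {n k g} .{{_ : NonZero n}} .{{_ : NonZero g}} →
                         3 ∣ g → 3 * g ∣ n → g ∣ k → ¬ (3 * g ∣ k) → PeriodicTotalColouring n k 5
prismPeriodicColouring {n} {k} {g} 3∣g 3g∣n g∣k 3g∤k =
  byResidue (k / g % 3) (m%n<n (k / g) 3) k%3g≡[k/g%3]*g
  where
  instance
    3g≢0 : NonZero (3 * g)
    3g≢0 = m*n≢0 3 g
  k%3g≡[k/g%3]*g : k % (3 * g) ≡ k / g % 3 * g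
  k%3g≡[k/g%3]*g = begin
    k % (3 * g)         ≡⟨ cong (_% (3 * g)) (m/n*n≡m g∣k) ⟨
    k / g * g % (3 * g) ≡⟨ m%n*o≡m*o%[n*o] (k / g) 3 g ⟨
    k / g % 3 * g       ∎
    where open ≡-Reasoning
  0<g : 0 < g
  0<g = >-nonZero⁻¹ g
  byResidue : ∀ j → j < 3 → k % (3 * g) ≡ j * g → PeriodicTotalColouring n k 5
  byResidue 0 _ k≡0 = ⊥-elim (3g∤k (m%n≡0⇒n∣m k (3 * g) k≡0))
  byResidue 1 _ k≡g = liftPeriod 3g∣n
    (trans k≡g (trans (+-identityʳ g) (sym (m<n⇒m%n≡m (m<3*m 0<g)))))
    (Prism.prism g 3∣g)
  byResidue 2 _ k≡2g = liftPeriod 3g∣n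
    (trans k≡2g (sym (m<n⇒m%n≡m (m<n+m (2 * g) 0<g))))
    (negateJump (n%n≡0 (3 * g)) (Prism.prism g 3∣g))
  byResidue (suc (suc (suc j))) j<3 _ = ⊥-elim (m+n≮m 3 j j<3)

quotByGcd-spec : ∀ n k (gcd≢0 : gcd n k ≢ 0) → quotByGcd n k ≡ (n / gcd n k) {{≢-nonZero gcd≢0}}
quotByGcd-spec n k gcd≢0 with gcd n k ≟ 0
... | yes gcd≡0 = ⊥-elim (gcd≢0 gcd≡0)
... | no _      = refl

quotByGcd≡3s⇒3gcd∣n : ∀ n k {s} (gcd≢0 : gcd n k ≢ 0) → quotByGcd n k ≡ 3 * s → 3 * gcd n k ∣ n
quotByGcd≡3s⇒3gcd∣n n k {s} gcd≢0 quot≡3s = divides s (begin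
  n           ≡⟨ m*[n/m]≡n (gcd[m,n]∣m n k) ⟨
  g * (n / g) ≡⟨ cong (g *_) (trans (sym (quotByGcd-spec n k gcd≢0)) quot≡3s) ⟩
  g * (3 * s) ≡⟨ x∙yz≈y∙xz *-commutativeSemigroup g 3 s ⟩
  3 * (g * s) ≡⟨ *-assoc 3 g s ⟨
  3 * g * s   ≡⟨ *-comm (3 * g) s ⟩
  s * (3 * g) ∎)
  where
  open ≡-Reasoning
  g : ℕ
  g = gcd n k
  instance
    g≢0 : NonZero g
    g≢0 = ≢-nonZero gcd≢0

periodicColouring : ∀ p k → (∃ λ s → 1 ≤ s × quotByGcd (9 * suc p) k ≡ 3 * s) →
                    PeriodicTotalColouring (9 * suc p) k 5
periodicColouring p k (s , _ , quot≡3s) with k % 9 in k%9≡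
... | 0 = prismPeriodicColouring 3∣g 3g∣N (gcd[m,n]∣n N k) (3g∤g g ∘ gcd-greatest 3g∣N)
  where
  N g : ℕ
  N = 9 * suc p
  g = gcd N k
  gcd≢0 : g ≢ 0
  gcd≢0 = gcd[m,n]≢0 N k (inj₁ λ ())
  instance
    g≢0 : NonZero g
    g≢0 = ≢-nonZero gcd≢0
  3∣g : 3 ∣ g
  3∣g = ∣-trans (divides 3 refl) (gcd-greatest (m∣m*n (suc p)) (m%n≡0⇒n∣m k 9 k%9≡))
  3g∣N : 3 * g ∣ N
  3g∣N = quotByGcd≡3s⇒3gcd∣n N k {s} gcd≢0 quot≡3s
... | 1 = liftPeriod (m∣m*n (suc p)) k%9≡ NineTables.nine₁
... | 2 = liftPeriod (m∣m*n (suc p)) k%9≡ NineTables.nine₂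
... | 3 = liftPeriod (m∣m*n (suc p)) k%9≡ NineTables.nine₃
... | 4 = liftPeriod (m∣m*n (suc p)) k%9≡ NineTables.nine₄
... | 5 = liftPeriod (m∣m*n (suc p)) k%9≡ NineTables.nine₅
... | 6 = liftPeriod (m∣m*n (suc p)) k%9≡ NineTables.nine₆
... | 7 = liftPeriod (m∣m*n (suc p)) k%9≡ NineTables.nine₇
... | 8 = liftPeriod (m∣m*n (suc p)) k%9≡ NineTables.nine₈
... | suc (suc (suc (suc (suc (suc (suc (suc (suc j)))))))) =
  ⊥-elim (m+n≮m 9 j (subst (_< 9) k%9≡ (m%n<n k 9)))

k≤n/2⇒k+k<1+n : ∀ {k} n → k ≤ n / 2 → k + k < suc n
k≤n/2⇒k+k<1+n {k} n k≤n/2 = s≤s (begin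
  k + k         ≤⟨ +-mono-≤ k≤n/2 k≤n/2 ⟩
  n / 2 + n / 2 ≡⟨ cong (n / 2 +_) (+-identityʳ (n / 2)) ⟨
  2 * (n / 2)   ≡⟨ *-comm 2 (n / 2) ⟩
  n / 2 * 2     ≤⟨ m/n*n≤m n 2 ⟩
  n             ∎)
  where open ≤-Reasoning

theorem2p3 : ∀ (p k : ℕ) → 1 ≤ p → 2 ≤ k → k ≤ (9 * p ∸ 1) / 2 →
    (∃ λ s → 1 ≤ s × quotByGcd (9 * p) k ≡ 3 * s) →
    TotalChromaticNumber≡ (Circulant (9 * p) (1 ∷ k ∷ [])) 5
theorem2p3 (suc p) k _ 2≤k k≤ quot≡3s =
    FromPeriodic.totalColouring 2≤k 2k<N (periodicColouring p k quot≡3s)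
  , λ m m<5 → circulant-¬TotalColoring 2≤k 2k<N (≤-pred m<5)
  where
  2k<N : k + k < 9 * suc p
  2k<N = k≤n/2⇒k+k<1+n (9 * suc p ∸ 1) k≤
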